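{- Every trivially perfect graph is module-composed.
   Context: All graphs are finite, simple and undirected. A graph is trivially perfect if for every induced subgraph $H$ the maximum size of an independent set of $H$ equals the number of maximal cliques of $H$. For a graph $G=(V_G,E_G)$ and $v\in V_G$, $N(v)=\{w\in V_G : \{v,w\}\in E_G\}$. A set $M\subseteq V_G$ is a module of $G$ if for all $v_1,v_2\in M$ we have $N(v_1)\setminus M=N(v_2)\setminus M$ (in particular the empty set, singletons and $V_G$ are modules). For $U\subseteq V_G$, $G[U]$ is the induced subgraph on $U$. A graph $G$ is module-composed if there is a bijection $\varphi:V_G\to\{1,\ldots,|V_G|\}$ such that for every $2\le i\le |V_G|$ the neighbourhood of $\varphi^{ -1}(i)$ in the graph $G[\{\varphi^{ -1}(1),\ldots,\varphi^{ -1}(i-1)\}]$ is a module of that graph. -}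

module Defs where

open import Data.Nat using (ℕ; _≤_; _<_; _≥_)
open import Data.Bool using (Bool; true; false)
open import Data.Fin using (Fin; toℕ)
open import Data.Fin.Subset using (Subset; _∈_; _∉_; _⊆_; ∣_∣; Nonempty)
open import Data.Product using (Σ; ∃; _×_)
open import Data.List using (List; length)
import Data.List.Membership.Propositional as L
open import Data.List.Relation.Unary.Unique.Propositional using (Unique)
open import Relation.Binary.PropositionalEquality using (_≡_; _≢_)
open import Relation.Nullary using (¬_)
open import Function.Bundles using (_↔_; _⇔_; Inverse)

record Graph : Set where
  field
    n      : ℕ
    adj    : Fin n → Fin n → Bool
    sym    : ∀ i j → adj i j ≡ adj j i
    irrefl : ∀ i → adj i i ≡ false

module _ (G : Graph) where
  open Graph G

  IsIndependent : Subset n → Subset n → Set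
  IsIndependent U S = S ⊆ U × (∀ i j → i ∈ S → j ∈ S → adj i j ≡ false)

  IsClique : Subset n → Subset n → Set
  IsClique U C = C ⊆ U × (∀ i j → i ∈ C → j ∈ C → i ≢ j → adj i j ≡ true)

  IsMaximalClique : Subset n → Subset n → Set
  IsMaximalClique U C =
    IsClique U C × (∀ C' → IsClique U C' → C ⊆ C' → C' ⊆ C)

  IndependenceNumber : Subset n → ℕ → Set
  IndependenceNumber U k =
    (∃ λ S → IsIndependent U S × ∣ S ∣ ≡ k)
    × (∀ S → IsIndependent U S → ∣ S ∣ ≤ k)

  NumberOfMaximalCliques : Subset n → ℕ → Set
  NumberOfMaximalCliques U k =
    ∃ λ (Cs : List (Subset n)) →
      length Cs ≡ k × Unique Cs × (∀ C → (C L.∈ Cs) ⇔ IsMaximalClique U C)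

  TriviallyPerfect : Set
  TriviallyPerfect =
    ∀ (U : Subset n) → Nonempty U →
      ∃ λ k → IndependenceNumber U k × NumberOfMaximalCliques U k

  IsModuleOf : (Fin n → Set) → (Fin n → Set) → Set
  IsModuleOf P M =
    (∀ x → M x → P x) ×
    (∀ x y z → M x → M y → P z → ¬ M z → adj x z ≡ adj y z)

  -- module-composed: a bijection φ : V → {0,…,n-1} (0-based positions) such
  -- that for every vertex v not in first position, its neighbourhood in the
  -- subgraph induced by the vertices placed before v is a module of that subgraph
  ModuleComposed : Set
  ModuleComposed =
    Σ (Fin n ↔ Fin n) λ φ →
      let pos : Fin n → ℕ
          pos v = toℕ (Inverse.to φ v)
          before : Fin n → Fin n → Set
          before v w = pos w < pos v
      in ∀ v → pos v ≥ 1 →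
           IsModuleOf (before v) (λ w → before v w × adj v w ≡ true)

module Submission where

-- A trivially perfect graph has no induced path or cycle a–b–c–d (ac and bd
-- non-edges): on {a,b,c,d} every independent set has at most two vertices,
-- while the edges ab, bc, cd are three distinct maximal cliques.  Hence the
-- closed neighbourhoods of two adjacent vertices are nested, so a neighbour x
-- of v with deg x ≤ deg v satisfies N[x] ⊆ N[v].  Order the vertices by
-- increasing degree (ties broken by index).  Every neighbour x of v placed
-- before v then has N[x] ⊆ N[v], so x is adjacent to no earlier vertex
-- outside N(v); all earlier neighbours of v therefore agree on the earlier
-- non-neighbours, i.e. N(v) is a module of the graph induced on the earlier
-- vertices.

open import Defs
open import Data.Nat using (ℕ; zero; suc; _+_; _*_; _≤_; _<_; z≤n; s≤s)
open import Data.Nat.Properties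
  using (≤-trans; ≤-reflexive; <-≤-trans; <-trans; <-irrefl; <-asym; <-cmp; _<?_;
         ≤⇒≯; ≮⇒≥; 1+n≰n; +-suc; +-comm; +-monoʳ-≤; +-monoʳ-<; *-monoˡ-≤; m≤m+n;
         +-cancelˡ-≡; module ≤-Reasoning)
open import Data.Bool using (true; false)
open import Data.Bool.Properties using (¬-not) renaming (_≟_ to _≟ᵇ_)
open import Data.Fin using (Fin; toℕ; fromℕ<; punchOut) renaming (_≟_ to _≟ᶠ_)
open import Data.Fin.Properties using (any?; toℕ<n; toℕ-injective; toℕ-fromℕ<; punchOut-injective; injective⇒≤)
open import Data.Fin.Subset using (Subset; _∈_; _∉_; _⊆_; ∣_∣; ⁅_⁆; _∪_; inside; outside) renaming (⊥ to ∅)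
open import Data.Fin.Subset.Properties
  using (_∈?_; x∈⁅y⁆⇒x≡y; x∈⁅x⁆; x∈p∪q⁻; x∈p∪q⁺; ∉⊥; p⊆q⇒∣p∣≤∣q∣; p⊂q⇒∣p∣<∣q∣; ∣⁅x⁆∣≡1;
         ∣⊤∣≡n; ∣⊥∣≡0; ⊆⊤; ∈⊤; ∣p∣≤∣x∷p∣)
open import Data.Vec using (tabulate; _∷_; [])
open import Data.Vec.Properties using (lookup∘tabulate; []=⇒lookup; lookup⇒[]=)
open import Data.Product using (∃; _×_; _,_; proj₁; proj₂)
open import Data.Sum using (_⊎_; inj₁; inj₂)
open import Data.Empty using (⊥; ⊥-elim)
open import Data.List using (List; length) renaming (_∷_ to _∷ₗ_; [] to []ₗ)
open import Data.List.Relation.Unary.Any using (here; there)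
open import Data.List.Membership.Propositional using () renaming (_∈_ to _∈ₗ_)
open import Relation.Binary.PropositionalEquality using (_≡_; _≢_; refl; sym; trans; cong; subst)
open import Relation.Binary.Definitions using (tri<; tri≈; tri>)
open import Relation.Nullary using (¬_; yes; no; does; contradiction)
open import Relation.Nullary.Decidable using (dec-true; _⊎-dec_; _×-dec_; ¬?)
open import Relation.Unary using (Decidable)
open import Function.Bundles using (_↔_; _⇔_; Inverse; Equivalence; mk↔ₛ′)

deleteMember : ∀ {A : Set} {a : A} {xs : List A} → a ∈ₗ xs →
  ∃ λ ys → length xs ≡ suc (length ys) × (∀ {b} → b ∈ₗ xs → b ≢ a → b ∈ₗ ys)
deleteMember {xs = x ∷ₗ xs} (here refl) = xs , refl , keep
  where
    keep : ∀ {b} → b ∈ₗ x ∷ₗ xs → b ≢ x → b ∈ₗ xs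
    keep (here b≡x) b≢x = contradiction b≡x b≢x
    keep (there b∈xs) _ = b∈xs
deleteMember {a = a} {xs = x ∷ₗ xs} (there a∈xs) with deleteMember a∈xs
... | ys , length≡ , keep = x ∷ₗ ys , cong suc length≡ , keep′
  where
    keep′ : ∀ {b} → b ∈ₗ x ∷ₗ xs → b ≢ a → b ∈ₗ x ∷ₗ ys
    keep′ (here b≡x) _ = here b≡x
    keep′ (there b∈xs) b≢a = there (keep b∈xs b≢a)

three-distinct⇒3≤length : ∀ {A : Set} {a b c : A} {xs : List A} →
  a ∈ₗ xs → b ∈ₗ xs → c ∈ₗ xs → a ≢ b → a ≢ c → b ≢ c → 3 ≤ length xs
three-distinct⇒3≤length a∈ b∈ c∈ a≢b a≢c b≢c
  with deleteMember a∈
... | ys , len-xs , keep-a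
  with deleteMember (keep-a b∈ (λ b≡a → a≢b (sym b≡a)))
... | zs , len-ys , keep-b
  with deleteMember (keep-b (keep-a c∈ (λ c≡a → a≢c (sym c≡a))) (λ c≡b → b≢c (sym c≡b)))
... | ws , len-zs , _
  rewrite len-xs | len-ys | len-zs = s≤s (s≤s (s≤s z≤n))

pair : ∀ {A : Set} → A → A → List A
pair x y = x ∷ₗ y ∷ₗ []ₗ

∣p∪q∣≤∣p∣+∣q∣ : ∀ {n} (p q : Subset n) → ∣ p ∪ q ∣ ≤ ∣ p ∣ + ∣ q ∣
∣p∪q∣≤∣p∣+∣q∣ [] [] = z≤n
∣p∪q∣≤∣p∣+∣q∣ (outside ∷ p) (outside ∷ q) = ∣p∪q∣≤∣p∣+∣q∣ p q
∣p∪q∣≤∣p∣+∣q∣ (outside ∷ p) (inside ∷ q) =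
  ≤-trans (s≤s (∣p∪q∣≤∣p∣+∣q∣ p q)) (≤-reflexive (sym (+-suc ∣ p ∣ ∣ q ∣)))
∣p∪q∣≤∣p∣+∣q∣ (inside ∷ p) (s ∷ q) =
  s≤s (≤-trans (∣p∪q∣≤∣p∣+∣q∣ p q) (+-monoʳ-≤ ∣ p ∣ (∣p∣≤∣x∷p∣ s q)))

⊆∧∣∣≤⇒⊇ : ∀ {n} {p q : Subset n} → p ⊆ q → ∣ q ∣ ≤ ∣ p ∣ → q ⊆ p
⊆∧∣∣≤⇒⊇ {p = p} p⊆q ∣q∣≤∣p∣ {x} x∈q with x ∈? p
... | yes x∈p = x∈p
... | no x∉p = contradiction (p⊂q⇒∣p∣<∣q∣ (p⊆q , x , x∈q , x∉p)) (≤⇒≯ ∣q∣≤∣p∣)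

select : ∀ {n} {P : Fin n → Set} → Decidable P → Subset n
select P? = tabulate (λ i → does (P? i))

∈select⁺ : ∀ {n} {P : Fin n → Set} (P? : Decidable P) {x} → P x → x ∈ select P?
∈select⁺ P? {x} Px = lookup⇒[]= x _ (trans (lookup∘tabulate _ x) (dec-true (P? x) Px))

∈select⁻ : ∀ {n} {P : Fin n → Set} (P? : Decidable P) {x} → x ∈ select P? → P x
∈select⁻ P? {x} x∈ with P? x | trans (sym (lookup∘tabulate (λ i → does (P? i)) x)) ([]=⇒lookup x∈)
... | yes Px | _ = Px
... | no _ | ()

⟦_⟧ : ∀ {n} → List (Fin n) → Subset n
⟦ []ₗ ⟧ = ∅
⟦ x ∷ₗ xs ⟧ = ⁅ x ⁆ ∪ ⟦ xs ⟧

∈⟦⟧⁺ : ∀ {n} (xs : List (Fin n)) {y} → y ∈ₗ xs → y ∈ ⟦ xs ⟧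
∈⟦⟧⁺ (x ∷ₗ _) (here refl) = x∈p∪q⁺ (inj₁ (x∈⁅x⁆ x))
∈⟦⟧⁺ (x ∷ₗ xs) (there y∈xs) = x∈p∪q⁺ {p = ⁅ x ⁆} (inj₂ (∈⟦⟧⁺ xs y∈xs))

∈⟦⟧⁻ : ∀ {n} (xs : List (Fin n)) {y} → y ∈ ⟦ xs ⟧ → y ∈ₗ xs
∈⟦⟧⁻ []ₗ y∈∅ = contradiction y∈∅ ∉⊥
∈⟦⟧⁻ (x ∷ₗ xs) y∈ with x∈p∪q⁻ ⁅ x ⁆ ⟦ xs ⟧ y∈
... | inj₁ y∈⁅x⁆ = here (x∈⁅y⁆⇒x≡y x y∈⁅x⁆)
... | inj₂ y∈xs = there (∈⟦⟧⁻ xs y∈xs)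

∣⟦⟧∣≤length : ∀ {n} (xs : List (Fin n)) → ∣ ⟦ xs ⟧ ∣ ≤ length xs
∣⟦⟧∣≤length {n} []ₗ = ≤-reflexive (∣⊥∣≡0 n)
∣⟦⟧∣≤length (x ∷ₗ xs) = ≤-trans (∣p∪q∣≤∣p∣+∣q∣ ⁅ x ⁆ ⟦ xs ⟧)
  (≤-trans (≤-reflexive (cong (_+ ∣ ⟦ xs ⟧ ∣) (∣⁅x⁆∣≡1 x))) (s≤s (∣⟦⟧∣≤length xs)))

⊆list⇒∣∣≤length : ∀ {n} {S : Subset n} (xs : List (Fin n)) → (∀ {y} → y ∈ S → y ∈ₗ xs) →
  ∣ S ∣ ≤ length xs
⊆list⇒∣∣≤length {S = S} xs S⊆xs =
  ≤-trans (p⊆q⇒∣p∣≤∣q∣ {p = S} {q = ⟦ xs ⟧} (λ y∈S → ∈⟦⟧⁺ xs (S⊆xs y∈S))) (∣⟦⟧∣≤length xs)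

pair-≢ : ∀ {n} {x y p q : Fin n} → x ≢ p → x ≢ q →
  ⟦ pair x y ⟧ ≢ ⟦ pair p q ⟧
pair-≢ {x = x} {y} {p} {q} x≢p x≢q eq
  with ∈⟦⟧⁻ (pair p q) (subst (x ∈_) eq (∈⟦⟧⁺ (pair x y) (here refl)))
... | here x≡p = x≢p x≡p
... | there (here x≡q) = x≢q x≡q

-- An injective map Fin n → Fin n is surjective: a missed value j would make
-- punchOut j ∘ f an injection Fin (1 + m) → Fin m.
injective⇒surjective : ∀ {n} {f : Fin n → Fin n} → (∀ {a b} → f a ≡ f b → a ≡ b) →
  ∀ j → ∃ λ i → f i ≡ j
injective⇒surjective {zero} _ ()
injective⇒surjective {suc m} {f} f-inj j with any? (λ i → f i ≟ᶠ j)
... | yes hit = hit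
... | no missed = contradiction (injective⇒≤ punched-injective) 1+n≰n
  where
    j≢f : ∀ i → j ≢ f i
    j≢f i j≡fi = missed (i , sym j≡fi)
    punched-injective : ∀ {a b} → punchOut (j≢f a) ≡ punchOut (j≢f b) → a ≡ b
    punched-injective eq = f-inj (punchOut-injective (j≢f _) (j≢f _) eq)

-- Sorting Fin n by an injective key into ℕ: the position of v is the number of
-- elements with smaller key.  This gives a bijection of Fin n whose order on
-- positions agrees with the key order.
module Ranking {n : ℕ} (key : Fin n → ℕ) (key-injective : ∀ {u v} → key u ≡ key v → u ≡ v) where

  smaller? : ∀ v → Decidable (λ u → key u < key v)
  smaller? v u = key u <? key v

  below : Fin n → Subset n
  below v = select (smaller? v)

  rank : Fin n → ℕ
  rank v = ∣ below v ∣

  rank-mono : ∀ {w v} → key w ≤ key v → rank w ≤ rank v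
  rank-mono {w} {v} w≤v = p⊆q⇒∣p∣≤∣q∣ {p = below w} {q = below v}
    λ u∈ → ∈select⁺ (smaller? v) (<-≤-trans (∈select⁻ (smaller? w) u∈) w≤v)

  rank-strict : ∀ {w v} → key w < key v → rank w < rank v
  rank-strict {w} {v} w<v = p⊂q⇒∣p∣<∣q∣ {p = below w} {q = below v}
    ( (λ u∈ → ∈select⁺ (smaller? v) (<-trans (∈select⁻ (smaller? w) u∈) w<v))
    , w , ∈select⁺ (smaller? v) w<v , λ w∈ → <-irrefl refl (∈select⁻ (smaller? w) w∈) )

  rank<n : ∀ v → rank v < n
  rank<n v = <-≤-trans
    (p⊂q⇒∣p∣<∣q∣ {p = below v} (⊆⊤ , v , ∈⊤ , λ v∈ → <-irrefl refl (∈select⁻ (smaller? v) v∈)))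
    (≤-reflexive (∣⊤∣≡n n))

  rank-reflects : ∀ {w v} → rank w < rank v → key w < key v
  rank-reflects {w} {v} rw<rv with key w <? key v
  ... | yes w<v = w<v
  ... | no w≮v = contradiction rw<rv (≤⇒≯ (rank-mono (≮⇒≥ w≮v)))

  rank-injective : ∀ {w v} → rank w ≡ rank v → w ≡ v
  rank-injective {w} {v} eq with <-cmp (key w) (key v)
  ... | tri< w<v _ _ = ⊥-elim (<-irrefl eq (rank-strict w<v))
  ... | tri≈ _ w≡v _ = key-injective w≡v
  ... | tri> _ _ v<w = ⊥-elim (<-irrefl (sym eq) (rank-strict v<w))

  position : Fin n → Fin n
  position v = fromℕ< (rank<n v)

  position-injective : ∀ {w v} → position w ≡ position v → w ≡ v
  position-injective {w} {v} eq = rank-injective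
    (trans (sym (toℕ-fromℕ< (rank<n w))) (trans (cong toℕ eq) (toℕ-fromℕ< (rank<n v))))

  ranking : Fin n ↔ Fin n
  ranking = mk↔ₛ′ position unrank
    (λ j → proj₂ (injective⇒surjective position-injective j))
    (λ v → position-injective (proj₂ (injective⇒surjective position-injective (position v))))
    where
      unrank : Fin n → Fin n
      unrank j = proj₁ (injective⇒surjective position-injective j)

  ranking-reflects : ∀ {w v} →
    toℕ (Inverse.to ranking w) < toℕ (Inverse.to ranking v) → key w < key v
  ranking-reflects {w} {v} lt = rank-reflects
    (subst (_< rank v) (toℕ-fromℕ< (rank<n w)) (subst (_ <_) (toℕ-fromℕ< (rank<n v)) lt))

-- The lexicographic key (weight, index), encoded in ℕ as weight · n + index.
module WeightKey {n : ℕ} (weight : Fin n → ℕ) where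

  key : Fin n → ℕ
  key v = weight v * n + toℕ v

  key-strict : ∀ {w v} → weight w < weight v → key w < key v
  key-strict {w} {v} w<v = begin-strict
    weight w * n + toℕ w  <⟨ +-monoʳ-< (weight w * n) (toℕ<n w) ⟩
    weight w * n + n      ≡⟨ +-comm (weight w * n) n ⟩
    suc (weight w) * n    ≤⟨ *-monoˡ-≤ n w<v ⟩
    weight v * n          ≤⟨ m≤m+n (weight v * n) (toℕ v) ⟩
    weight v * n + toℕ v  ∎
    where open ≤-Reasoning

  key-injective : ∀ {w v} → key w ≡ key v → w ≡ v
  key-injective {w} {v} eq with <-cmp (weight w) (weight v)
  ... | tri< w<v _ _ = ⊥-elim (<-irrefl eq (key-strict w<v))
  ... | tri> _ _ v<w = ⊥-elim (<-irrefl (sym eq) (key-strict v<w))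
  ... | tri≈ _ w≡v _ = toℕ-injective
        (+-cancelˡ-≡ (weight v * n) _ _ (subst (λ t → t * n + toℕ w ≡ key v) w≡v eq))

  key-reflects-weight : ∀ {w v} → key w < key v → weight w ≤ weight v
  key-reflects-weight {w} {v} w<v with weight v <? weight w
  ... | yes v<w = contradiction w<v (<-asym (key-strict v<w))
  ... | no v≮w = ≮⇒≥ v≮w

module _ (G : Graph) where
  open Graph G renaming (sym to adj-sym)

  walk : Fin n → Fin n → Fin n → Fin n → List (Fin n)
  walk a b c d = a ∷ₗ b ∷ₗ c ∷ₗ d ∷ₗ []ₗ

  adj-swap : ∀ {x y} → adj x y ≡ true → adj y x ≡ true
  adj-swap {x} {y} xy = trans (adj-sym y x) xy

  no-loop : ∀ {x} → adj x x ≡ true → ⊥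
  no-loop {x} xx with trans (sym xx) (irrefl x)
  ... | ()

  adj⇒≢ : ∀ {x y} → adj x y ≡ true → x ≢ y
  adj⇒≢ xy refl = no-loop xy

  non-edge : ∀ {x y} → adj x y ≡ false → adj x y ≡ true → ⊥
  non-edge xy≡false xy with trans (sym xy) xy≡false
  ... | ()

  non-edge-swap : ∀ {x y} → adj x y ≡ false → adj y x ≡ true → ⊥
  non-edge-swap xy≡false yx = non-edge xy≡false (adj-swap yx)

  edge-maximalClique : ∀ U p q → p ∈ U → q ∈ U → adj p q ≡ true →
    (∀ y → y ∈ U → adj y p ≡ true → adj y q ≡ true → ⊥) →
    IsMaximalClique G U ⟦ pair p q ⟧
  edge-maximalClique U p q p∈U q∈U pq no-triangle = (inside-U , complete) , maximal
    where
      inside-U : ⟦ pair p q ⟧ ⊆ U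
      inside-U y∈ with ∈⟦⟧⁻ (pair p q) y∈
      ... | here refl = p∈U
      ... | there (here refl) = q∈U

      complete : ∀ i j → i ∈ ⟦ pair p q ⟧ → j ∈ ⟦ pair p q ⟧ → i ≢ j → adj i j ≡ true
      complete i j i∈ j∈ i≢j with ∈⟦⟧⁻ (pair p q) i∈ | ∈⟦⟧⁻ (pair p q) j∈
      ... | here refl | here refl = contradiction refl i≢j
      ... | here refl | there (here refl) = pq
      ... | there (here refl) | here refl = adj-swap pq
      ... | there (here refl) | there (here refl) = contradiction refl i≢j

      maximal : ∀ C → IsClique G U C → ⟦ pair p q ⟧ ⊆ C → C ⊆ ⟦ pair p q ⟧
      maximal C (C⊆U , C-complete) pq⊆C {y} y∈C with y ≟ᶠ p | y ≟ᶠ q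
      ... | yes refl | _ = ∈⟦⟧⁺ (pair p q) (here refl)
      ... | no _ | yes refl = ∈⟦⟧⁺ (pair p q) (there (here refl))
      ... | no y≢p | no y≢q = ⊥-elim (no-triangle y (C⊆U y∈C)
            (C-complete y p y∈C (pq⊆C (∈⟦⟧⁺ (pair p q) (here refl))) y≢p)
            (C-complete y q y∈C (pq⊆C (∈⟦⟧⁺ (pair p q) (there (here refl)))) y≢q))

  -- On the vertices of a path a–b–c–d every independent set has at most two
  -- vertices: it lies in {b,d} if it contains b, in {a,c} if it contains c,
  -- and in {a,d} otherwise.
  path-independent≤2 : ∀ {a b c d S} → adj a b ≡ true → adj b c ≡ true → adj c d ≡ true →
    IsIndependent G ⟦ walk a b c d ⟧ S → ∣ S ∣ ≤ 2
  path-independent≤2 {a} {b} {c} {d} {S} ab bc cd (S⊆U , independent) with b ∈? S | c ∈? S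
  ... | yes b∈S | _ =
    ⊆list⇒∣∣≤length (pair b d) λ y∈S → with-b (∈⟦⟧⁻ (walk a b c d) (S⊆U y∈S)) y∈S
    where
      with-b : ∀ {y} → y ∈ₗ walk a b c d → y ∈ S → y ∈ₗ pair b d
      with-b (here refl) a∈S = ⊥-elim (non-edge (independent a b a∈S b∈S) ab)
      with-b (there (here refl)) _ = here refl
      with-b (there (there (here refl))) c∈S = ⊥-elim (non-edge-swap (independent c b c∈S b∈S) bc)
      with-b (there (there (there (here refl)))) _ = there (here refl)
  ... | no b∉S | yes c∈S =
    ⊆list⇒∣∣≤length (pair a c) λ y∈S → with-c (∈⟦⟧⁻ (walk a b c d) (S⊆U y∈S)) y∈S
    where
      with-c : ∀ {y} → y ∈ₗ walk a b c d → y ∈ S → y ∈ₗ pair a c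
      with-c (here refl) _ = here refl
      with-c (there (here refl)) b∈S = contradiction b∈S b∉S
      with-c (there (there (here refl))) _ = there (here refl)
      with-c (there (there (there (here refl)))) d∈S = ⊥-elim (non-edge-swap (independent d c d∈S c∈S) cd)
  ... | no b∉S | no c∉S =
    ⊆list⇒∣∣≤length (pair a d) λ y∈S → without-bc (∈⟦⟧⁻ (walk a b c d) (S⊆U y∈S)) y∈S
    where
      without-bc : ∀ {y} → y ∈ₗ walk a b c d → y ∈ S → y ∈ₗ pair a d
      without-bc (here refl) _ = here refl
      without-bc (there (here refl)) b∈S = contradiction b∈S b∉S
      without-bc (there (there (here refl))) c∈S = contradiction c∈S c∉S
      without-bc (there (there (there (here refl)))) _ = there (here refl)

  path-three-maximalCliques : ∀ {a b c d} → adj a b ≡ true → adj b c ≡ true → adj c d ≡ true →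
    adj a c ≡ false → adj b d ≡ false → a ≢ c → b ≢ d →
    ∀ Cs → (∀ C → (C ∈ₗ Cs) ⇔ IsMaximalClique G ⟦ walk a b c d ⟧ C) →
    3 ≤ length Cs
  path-three-maximalCliques {a} {b} {c} {d} ab bc cd ac bd a≢c b≢d Cs Cs-maximal =
    three-distinct⇒3≤length
      (listed (here refl) (there (here refl)) ab triangle-free-ab)
      (listed (there (here refl)) (there (there (here refl))) bc triangle-free-bc)
      (listed (there (there (here refl))) (there (there (there (here refl)))) cd triangle-free-cd)
      (pair-≢ (adj⇒≢ ab) a≢c) (pair-≢ a≢c a≢d) (pair-≢ (adj⇒≢ bc) b≢d)
    where
      U : Subset n
      U = ⟦ walk a b c d ⟧

      a≢d : a ≢ d
      a≢d refl = non-edge-swap ac cd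

      listed : ∀ {p q} → p ∈ₗ walk a b c d → q ∈ₗ walk a b c d →
        adj p q ≡ true → (∀ y → y ∈ U → adj y p ≡ true → adj y q ≡ true → ⊥) →
        ⟦ pair p q ⟧ ∈ₗ Cs
      listed {p} {q} p∈ q∈ pq no-triangle = Equivalence.from (Cs-maximal _)
        (edge-maximalClique U p q (∈⟦⟧⁺ _ p∈) (∈⟦⟧⁺ _ q∈) pq no-triangle)

      triangle-free-ab : ∀ y → y ∈ U → adj y a ≡ true → adj y b ≡ true → ⊥
      triangle-free-ab y y∈U ya yb with ∈⟦⟧⁻ (walk a b c d) y∈U
      ... | here refl = no-loop ya
      ... | there (here refl) = no-loop yb
      ... | there (there (here refl)) = non-edge-swap ac ya
      ... | there (there (there (here refl))) = non-edge-swap bd yb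

      triangle-free-bc : ∀ y → y ∈ U → adj y b ≡ true → adj y c ≡ true → ⊥
      triangle-free-bc y y∈U yb yc with ∈⟦⟧⁻ (walk a b c d) y∈U
      ... | here refl = non-edge ac yc
      ... | there (here refl) = no-loop yb
      ... | there (there (here refl)) = no-loop yc
      ... | there (there (there (here refl))) = non-edge-swap bd yb

      triangle-free-cd : ∀ y → y ∈ U → adj y c ≡ true → adj y d ≡ true → ⊥
      triangle-free-cd y y∈U yc yd with ∈⟦⟧⁻ (walk a b c d) y∈U
      ... | here refl = non-edge ac yc
      ... | there (here refl) = non-edge bd yd
      ... | there (there (here refl)) = no-loop yc
      ... | there (there (there (here refl))) = no-loop yd

  closed? : ∀ v → Decidable (λ u → adj v u ≡ true ⊎ v ≡ u)
  closed? v u = (adj v u ≟ᵇ true) ⊎-dec (v ≟ᶠ u)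

  N[_] : Fin n → Subset n
  N[ v ] = select (closed? v)

  degree : Fin n → ℕ
  degree v = ∣ N[ v ] ∣

  self∈N : ∀ {v} → v ∈ N[ v ]
  self∈N {v} = ∈select⁺ (closed? v) (inj₂ refl)

  adj⇒∈N : ∀ {v u} → adj v u ≡ true → u ∈ N[ v ]
  adj⇒∈N {v} vu = ∈select⁺ (closed? v) (inj₁ vu)

  ∈N⇒adj : ∀ {v u} → u ∈ N[ v ] → v ≢ u → adj v u ≡ true
  ∈N⇒adj {v} u∈ v≢u with ∈select⁻ (closed? v) u∈
  ... | inj₁ vu = vu
  ... | inj₂ v≡u = contradiction v≡u v≢u

  ∉N⇒non-adjacent : ∀ {v u} → u ∉ N[ v ] → adj v u ≡ false
  ∉N⇒non-adjacent u∉ = ¬-not (λ vu → u∉ (adj⇒∈N vu))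

  module _ (tp : TriviallyPerfect G) where

    -- A trivially perfect graph has no induced path or cycle a–b–c–d: its
    -- independence number would be at most 2 but it has at least 3 maximal
    -- cliques.
    no-induced-P4-C4 : ∀ a b c d → adj a b ≡ true → adj b c ≡ true → adj c d ≡ true →
      adj a c ≡ false → adj b d ≡ false → a ≢ c → b ≢ d → ⊥
    no-induced-P4-C4 a b c d ab bc cd ac bd a≢c b≢d
      with tp ⟦ walk a b c d ⟧ (a , ∈⟦⟧⁺ (walk a b c d) (here refl))
    ... | k , ((S , S-independent , ∣S∣≡k) , _) , (Cs , length≡k , _ , Cs-maximal) =
      ≤⇒≯ (path-independent≤2 ab bc cd S-independent) 2<∣S∣
      where
        2<∣S∣ : 2 < ∣ S ∣
        2<∣S∣ = subst (3 ≤_) (trans length≡k (sym ∣S∣≡k))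
                  (path-three-maximalCliques ab bc cd ac bd a≢c b≢d Cs Cs-maximal)

    -- Closed neighbourhoods of adjacent vertices are nested: a vertex w in
    -- N[v] ∖ N[x] and a vertex z in N[x] ∖ N[v] would give an induced w–v–x–z.
    nested : ∀ {v x} → adj v x ≡ true → N[ x ] ⊆ N[ v ] ⊎ N[ v ] ⊆ N[ x ]
    nested {v} {x} vx with any? (λ w → w ∈? N[ v ] ×-dec ¬? (w ∈? N[ x ]))
    ... | no no-witness = inj₂ v⊆x
      where
        v⊆x : N[ v ] ⊆ N[ x ]
        v⊆x {w} w∈N[v] with w ∈? N[ x ]
        ... | yes w∈N[x] = w∈N[x]
        ... | no w∉N[x] = contradiction (w , w∈N[v] , w∉N[x]) no-witness
    ... | yes (w , w∈N[v] , w∉N[x]) = inj₁ x⊆v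
      where
        v≢w : v ≢ w
        v≢w refl = w∉N[x] (adj⇒∈N (adj-swap vx))
        x⊆v : N[ x ] ⊆ N[ v ]
        x⊆v {z} z∈N[x] with z ∈? N[ v ]
        ... | yes z∈N[v] = z∈N[v]
        ... | no z∉N[v] = ⊥-elim (no-induced-P4-C4 w v x z
              (adj-swap (∈N⇒adj w∈N[v] v≢w)) vx (∈N⇒adj z∈N[x] x≢z)
              (trans (adj-sym w x) (∉N⇒non-adjacent w∉N[x])) (∉N⇒non-adjacent z∉N[v])
              (λ { refl → w∉N[x] self∈N }) (λ { refl → z∉N[v] self∈N }))
          where
            x≢z : x ≢ z
            x≢z refl = z∉N[v] (adj⇒∈N vx)

    dominated : ∀ {v x} → adj v x ≡ true → degree x ≤ degree v → N[ x ] ⊆ N[ v ]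
    dominated vx deg≤ with nested vx
    ... | inj₁ x⊆v = x⊆v
    ... | inj₂ v⊆x = ⊆∧∣∣≤⇒⊇ v⊆x deg≤

    dominated-non-adjacent : ∀ {v x z} → adj v x ≡ true → degree x ≤ degree v →
      adj v z ≡ false → v ≢ z → adj x z ≡ false
    dominated-non-adjacent {v} vx deg≤ vz≡false v≢z = ¬-not λ xz →
      non-edge vz≡false (∈N⇒adj (dominated vx deg≤ (adj⇒∈N xz)) v≢z)

-- Order the vertices by increasing degree.  For a vertex v let M be its set of
-- earlier neighbours and z an earlier non-neighbour: every x ∈ M has degree at
-- most deg v, hence is non-adjacent to z, so all of M agrees on z.
corollary2 : ∀ (G : Graph) → TriviallyPerfect G → ModuleComposed G
corollary2 G tp = ranking , λ v _ →
  (λ _ → proj₁) ,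
  λ x y z x∈M y∈M z-earlier z∉M →
    trans (outside-M v x z x∈M z-earlier z∉M) (sym (outside-M v y z y∈M z-earlier z∉M))
  where
    open Graph G using (n; adj)
    open WeightKey (degree G)
    open Ranking key key-injective

    earlier : Fin n → Fin n → Set
    earlier v w = toℕ (Inverse.to ranking w) < toℕ (Inverse.to ranking v)

    outside-M : ∀ v x z → earlier v x × adj v x ≡ true → earlier v z →
      ¬ (earlier v z × adj v z ≡ true) → adj x z ≡ false
    outside-M v x z (x-earlier , vx) z-earlier z∉M =
      dominated-non-adjacent G tp vx (key-reflects-weight (ranking-reflects x-earlier))
        (¬-not (λ vz → z∉M (z-earlier , vz))) (λ { refl → <-irrefl refl z-earlier })
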